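{- For every integer $a\ge 3$, Player 1 has a winning strategy in the $(a,3)$-game.
   Context: For positive integers $a,b$, the $(a,b)$-game is the following two-player game. Players 1 and 2 alternate moves, Player 1 moving first. After $n$ moves the game state is a permutation $\pi\in\mathcal{S}_n$ (the first move produces $\pi=1$). A move from $\pi\in\mathcal{S}_n$ consists of choosing any $m\in\{1,\dots,n+1\}$ and replacing $\pi$ by $\pi'=\pi'_1\cdots\pi'_n m\in\mathcal{S}_{n+1}$, where $\pi'_i=\pi_i$ if $\pi_i\le m-1$ and $\pi'_i=\pi_i+1$ if $\pi_i\ge m$. The game ends as soon as the current permutation contains an increasing subsequence of length $a$ or a decreasing subsequence of length $b$; the player who made that move loses (the other player wins). -}

module Defs where

open import Data.Nat using (ℕ; zero; suc; _<_; _>_; _≤_; _<?_)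
open import Data.List using (List; []; _∷_; map; length; _++_; [_])
open import Data.List.Relation.Binary.Sublist.Propositional using (_⊆_)
open import Data.List.Relation.Unary.Linked using (Linked)
open import Data.Product using (Σ; _×_)
open import Data.Sum using (_⊎_)
open import Data.Bool using (if_then_else_)
open import Relation.Nullary using (¬_)
open import Relation.Nullary.Decidable using (⌊_⌋)
open import Relation.Binary.PropositionalEquality using (_≡_)

-- A permutation π ∈ S_n is represented as the list π₁ ⋯ πₙ of its values
-- (a rearrangement of 1,…,n).  The empty list is the state before any move.

extend : List ℕ → ℕ → List ℕ
extend π m = map (λ x → if ⌊ x <? m ⌋ then x else suc x) π ++ [ m ]

HasIncreasing : ℕ → List ℕ → Set
HasIncreasing k π = Σ (List ℕ) λ s → s ⊆ π × length s ≡ k × Linked _<_ s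

HasDecreasing : ℕ → List ℕ → Set
HasDecreasing k π = Σ (List ℕ) λ s → s ⊆ π × length s ≡ k × Linked _>_ s

Ended : ℕ → ℕ → List ℕ → Set
Ended a b π = HasIncreasing a π ⊎ HasDecreasing b π

LegalMove : List ℕ → ℕ → Set
LegalMove π m = 1 ≤ m × m ≤ suc (length π)

-- Inductive, i.e. the player can force a
-- win in finitely many moves, which is what "has a winning strategy" means
-- for this (finite) game.
mutual
  data Wins (a b : ℕ) (π : List ℕ) : Set where
    wins : (m : ℕ) → LegalMove π m → ¬ Ended a b (extend π m) →
           Loses a b (extend π m) → Wins a b π

  -- the player to move at π loses against optimal play:
  -- every legal move either ends the game (so the mover loses) or
  -- leaves the opponent in a winning position
  data Loses (a b : ℕ) (π : List ℕ) : Set where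
    loses : ((m : ℕ) → LegalMove π m →
             Ended a b (extend π m) ⊎ Wins a b (extend π m)) → Loses a b π

Player1Wins : ℕ → ℕ → Set
Player1Wins a b = Wins a b []

{-# OPTIONS --safe #-}

-- Player 1 opens with 1 and keeps the following picture after each of her moves, π ∈ S_n: π has
-- no decreasing triple; the smaller entry of every inversion is at most a threshold B < n, and B
-- is itself the smaller entry of an inversion, so any reply m ≤ B completes a decreasing triple;
-- the longest increasing subsequence has length v + 1, but only v among the entries below n, and
-- some increasing subsequence of length v has all its entries ≤ B.
-- A reply m with B < m ≤ n is answered by the new maximum n + 2 (new threshold m), the reply
-- n + 1 by n (new threshold n); either answer restores the picture with v + 1 in place of v.
-- Once v + 3 = a she answers m by m + 1 and n + 1 by n + 1 instead: now an increasing subsequence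
-- of length a − 1 has entries at most the new threshold, which is the smaller entry of an
-- inversion, so every reply completes an increasing a-subsequence or a decreasing triple.

module Submission where

open import Defs
open import Data.Nat using (ℕ; zero; suc; _+_; _∸_; _≤_; _<_; _>_; _<?_; _≤?_; z≤n; s≤s)
open import Data.Nat.Properties
open import Data.List using (List; []; _∷_; map; length; _++_; [_])
open import Data.List.Properties using (length-map; length-++; map-id-local)
open import Data.List.Relation.Binary.Sublist.Propositional using (_⊆_; []; _∷_; _∷ʳ_; ⊆-refl)
open import Data.List.Relation.Binary.Sublist.Propositional.Properties
  using (map⁺; ++⁺; ++⁺ʳ; All-resp-⊆; length-mono-≤; []⊆-universal)
open import Data.List.Relation.Unary.All as All using (All; []; _∷_)
import Data.List.Relation.Unary.All.Properties as All
open import Data.List.Relation.Unary.Linked as Linked using (Linked; []; [-]; _∷_)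
import Data.List.Relation.Unary.Linked.Properties as Linked
open import Data.Product using (∃-syntax; _×_; _,_; proj₂; uncurry)
open import Data.Sum as Sum using (_⊎_; inj₁; inj₂)
open import Data.Bool using (if_then_else_)
open import Function using (_∘_; flip)
open import Relation.Binary.Definitions using (Transitive)
open import Relation.Nullary using (¬_; yes; no; contradiction)
open import Relation.Nullary.Decidable using (⌊_⌋)
open import Relation.Binary.PropositionalEquality using (_≡_; refl; sym; trans; cong; subst)

private
  variable
    m n u u′ x y B k v ℓ ℓ′ ℓ₀ : ℕ
    s t π : List ℕ

shift : ℕ → ℕ → ℕ
shift m x = if ⌊ x <? m ⌋ then x else suc x

shift-< : x < m → shift m x ≡ x
shift-< {x} {m} x<m with x <? m
... | yes _   = refl
... | no x≮m = contradiction x<m x≮m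

shift-≥ : m ≤ x → shift m x ≡ suc x
shift-≥ {m} {x} m≤x with x <? m
... | yes x<m = contradiction m≤x (<⇒≱ x<m)
... | no _    = refl

x≤shift : ∀ m x → x ≤ shift m x
x≤shift m x with x <? m
... | yes _ = ≤-refl
... | no _  = n≤1+n x

shift<⇒< : shift m x < u → x < u
shift<⇒< {m} {x} = ≤-<-trans (x≤shift m x)

shift≤suc : ∀ m x → shift m x ≤ suc x
shift≤suc m x with x <? m
... | yes _ = n≤1+n x
... | no _  = ≤-refl

shift-mono-< : ∀ m → x < y → shift m x < shift m y
shift-mono-< {x} {y} m x<y with x <? m | y <? m
... | yes _   | yes _   = x<y
... | yes _   | no _    = m≤n⇒m≤1+n x<y
... | no x≮m | yes y<m = contradiction (<-trans x<y y<m) x≮m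
... | no _    | no _    = s≤s x<y

shift-cancel-< : ∀ m → shift m x < shift m y → x < y
shift-cancel-< {x} {y} m x<y with x <? m | y <? m
... | yes _   | yes _   = x<y
... | yes x<m | no y≮m = <-≤-trans x<m (≮⇒≥ y≮m)
... | no x≮m | yes y<m =
  contradiction (<-trans (≤-<-trans (≮⇒≥ x≮m) (<-trans (n<1+n x) x<y)) y<m) (<-irrefl refl)
... | no _    | no _    = ≤-pred x<y

<shift⇒≤ : m < shift m x → m ≤ x
<shift⇒≤ {m} {x} m<x with x <? m
... | yes x<m = contradiction x<m (<-asym m<x)
... | no x≮m = ≮⇒≥ x≮m

shift<suc⇒< : m ≤ u → shift m x < suc u → x < u
shift<suc⇒< {m} {u} {x} m≤u x<u with x <? m
... | yes x<m = <-≤-trans x<m m≤u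
... | no _    = ≤-pred x<u

length-∷ʳ : ∀ (t : List ℕ) x → length (t ++ [ x ]) ≡ suc (length t)
length-∷ʳ t x = trans (length-++ t) (+-comm (length t) 1)

length-extend : ∀ π m → length (extend π m) ≡ suc (length π)
length-extend π m = trans (length-∷ʳ (map (shift m) π) m) (cong suc (length-map (shift m) π))

⊆-extend⁻ : ∀ π → s ⊆ extend π m →
  ∃[ t ] (t ⊆ π × (s ≡ map (shift m) t ⊎ s ≡ map (shift m) t ++ [ m ]))
⊆-extend⁻ []      (_ ∷ʳ [])   = [] , [] , inj₁ refl
⊆-extend⁻ []      (refl ∷ []) = [] , [] , inj₂ refl
⊆-extend⁻ (x ∷ π) (_ ∷ʳ p) with ⊆-extend⁻ π p
... | t , q , e = t , x ∷ʳ q , e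
⊆-extend⁻ {m = m} (x ∷ π) (refl ∷ p) with ⊆-extend⁻ π p
... | t , q , e = x ∷ t , refl ∷ q , Sum.map (cong (shift m x ∷_)) (cong (shift m x ∷_)) e

map-shift-⊆-extend : t ⊆ π → map (shift m) t ⊆ extend π m
map-shift-⊆-extend {m = m} p = ++⁺ʳ [ m ] (map⁺ (shift m) p)

map-shift-∷ʳ-⊆-extend : t ⊆ π → map (shift m) t ++ [ m ] ⊆ extend π m
map-shift-∷ʳ-⊆-extend {m = m} p = ++⁺ (map⁺ (shift m) p) ⊆-refl

map-shift-below : All (_< m) t → map (shift m) t ≡ t
map-shift-below = map-id-local ∘ All.map shift-<

⊆-extend-below : t ⊆ π → All (_< m) t → t ⊆ extend π m
⊆-extend-below p t<m = subst (_⊆ _) (map-shift-below t<m) (map-shift-⊆-extend p)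

∷ʳ-⊆-extend-below : t ⊆ π → All (_< m) t → t ++ [ m ] ⊆ extend π m
∷ʳ-⊆-extend-below {m = m} p t<m =
  subst (λ t′ → t′ ++ [ m ] ⊆ _) (map-shift-below t<m) (map-shift-∷ʳ-⊆-extend p)

inversion-⊆-extend : [ x ] ⊆ π → m ≤ x → suc x ∷ m ∷ [] ⊆ extend π m
inversion-⊆-extend {m = m} p m≤x =
  subst (λ x′ → x′ ∷ m ∷ [] ⊆ _) (shift-≥ m≤x) (map-shift-∷ʳ-⊆-extend p)

[suc]-⊆-extend : [ x ] ⊆ π → m ≤ x → [ suc x ] ⊆ extend π m
[suc]-⊆-extend p m≤x = subst (λ x′ → [ x′ ] ⊆ _) (shift-≥ m≤x) (map-shift-⊆-extend p)

module _ {A : Set} {R : A → A → Set} where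

  Linked-∷ʳ⁺ : ∀ {xs z} → Linked R xs → All (λ x → R x z) xs → Linked R (xs ++ [ z ])
  Linked-∷ʳ⁺ []        []         = [-]
  Linked-∷ʳ⁺ [-]       (Rxz ∷ []) = Rxz ∷ [-]
  Linked-∷ʳ⁺ (Rxy ∷ l) (_ ∷ Rxsz) = Rxy ∷ Linked-∷ʳ⁺ l Rxsz

  Linked-∷ʳ⁻ : Transitive R → ∀ xs {z} → Linked R (xs ++ [ z ]) →
               Linked R xs × All (λ x → R x z) xs
  Linked-∷ʳ⁻ R-trans []           _         = [] , []
  Linked-∷ʳ⁻ R-trans (x ∷ [])     (Rxz ∷ _) = [-] , Rxz ∷ []
  Linked-∷ʳ⁻ R-trans (x ∷ y ∷ xs) (Rxy ∷ l) with Linked-∷ʳ⁻ R-trans (y ∷ xs) l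
  ... | l′ , Ryz ∷ Rxsz = Rxy ∷ l′ , R-trans Rxy Ryz ∷ Ryz ∷ Rxsz

module _ {R : ℕ → ℕ → Set} (R-trans : Transitive R)
         (shift-reflects : ∀ {m x y} → R (shift m x) (shift m y) → R x y) where

  Linked-shift⁻ : Linked R (map (shift m) t) → Linked R t
  Linked-shift⁻ = Linked.map shift-reflects ∘ Linked.map⁻

  Linked-extend⁻ : ∀ π → s ⊆ extend π m → Linked R s →
    ∃[ t ] (t ⊆ π × Linked R t ×
            (s ≡ map (shift m) t ⊎ All (λ x → R (shift m x) m) t × s ≡ map (shift m) t ++ [ m ]))
  Linked-extend⁻ π p l with ⊆-extend⁻ π p
  ... | t , q , inj₁ refl = t , q , Linked-shift⁻ l , inj₁ refl
  ... | t , q , inj₂ refl with Linked-∷ʳ⁻ R-trans (map _ t) l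
  ...   | l′ , t<m = t , q , Linked-shift⁻ l′ , inj₂ (All.map⁻ t<m , refl)

increasing-extend⁻ : ∀ π → s ⊆ extend π m → Linked _<_ s →
  ∃[ t ] (t ⊆ π × Linked _<_ t ×
          (s ≡ map (shift m) t ⊎ All (λ x → shift m x < m) t × s ≡ map (shift m) t ++ [ m ]))
increasing-extend⁻ = Linked-extend⁻ <-trans (shift-cancel-< _)

decreasing-extend⁻ : ∀ π → s ⊆ extend π m → Linked _>_ s →
  ∃[ t ] (t ⊆ π × Linked _>_ t ×
          (s ≡ map (shift m) t ⊎ All (λ x → m < shift m x) t × s ≡ map (shift m) t ++ [ m ]))
decreasing-extend⁻ = Linked-extend⁻ (flip <-trans) (shift-cancel-< _)

IncreasingBelowAtMost : ℕ → ℕ → List ℕ → Set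
IncreasingBelowAtMost u ℓ π = ∀ {s} → s ⊆ π → Linked _<_ s → All (_< u) s → length s ≤ ℓ

IncreasingBelowAtMost-mono : u′ ≤ u → ℓ ≤ ℓ′ →
  IncreasingBelowAtMost u ℓ π → IncreasingBelowAtMost u′ ℓ′ π
IncreasingBelowAtMost-mono u′≤u ℓ≤ℓ′ h p l s<u′ =
  ≤-trans (h p l (All.map (λ x<u′ → <-≤-trans x<u′ u′≤u) s<u′)) ℓ≤ℓ′

IncreasingBelowAtMost-extend-above : u ≤ m →
  IncreasingBelowAtMost u ℓ π → IncreasingBelowAtMost u ℓ (extend π m)
IncreasingBelowAtMost-extend-above {π = π} u≤m h p l s<u with increasing-extend⁻ π p l
... | t , q , l′ , inj₁ refl =
  subst (_≤ _) (sym (length-map _ t)) (h q l′ (All.map shift<⇒< (All.map⁻ s<u)))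
... | t , q , l′ , inj₂ (_ , refl) = contradiction (proj₂ (All.∷ʳ⁻ s<u)) (≤⇒≯ u≤m)

IncreasingBelowAtMost-extend : m ≤ u →
  IncreasingBelowAtMost u ℓ π → IncreasingBelowAtMost m ℓ₀ π → ℓ₀ < ℓ →
  IncreasingBelowAtMost (suc u) ℓ (extend π m)
IncreasingBelowAtMost-extend {π = π} m≤u h h₀ ℓ₀<ℓ p l s<u with increasing-extend⁻ π p l
... | t , q , l′ , inj₁ refl =
  subst (_≤ _) (sym (length-map _ t)) (h q l′ (All.map (shift<suc⇒< m≤u) (All.map⁻ s<u)))
... | t , q , l′ , inj₂ (t<m , refl) = begin
  length (map _ t ++ [ _ ]) ≡⟨ length-∷ʳ (map _ t) _ ⟩
  suc (length (map _ t))    ≡⟨ cong suc (length-map _ t) ⟩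
  suc (length t)            ≤⟨ s≤s (h₀ q l′ (All.map shift<⇒< t<m)) ⟩
  suc _                     ≤⟨ ℓ₀<ℓ ⟩
  _                         ∎
  where open ≤-Reasoning

IncreasingBelowAtMost-extend-suc : m ≤ u → IncreasingBelowAtMost u ℓ π →
  IncreasingBelowAtMost (suc u) (suc ℓ) (extend π m)
IncreasingBelowAtMost-extend-suc m≤u h = IncreasingBelowAtMost-extend m≤u
  (IncreasingBelowAtMost-mono ≤-refl (n≤1+n _) h) (IncreasingBelowAtMost-mono m≤u ≤-refl h) ≤-refl

InversionsAtMost : ℕ → List ℕ → Set
InversionsAtMost B π = ∀ {x y} → x ∷ y ∷ [] ⊆ π → y < x → y ≤ B

inversion-extend⁻ : ∀ π → x ∷ y ∷ [] ⊆ extend π m → y < x →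
  (∃[ x′ ] ∃[ y′ ] (x′ ∷ y′ ∷ [] ⊆ π × y′ < x′ × y ≡ shift m y′)) ⊎
  (y ≡ m × ∃[ x′ ] ([ x′ ] ⊆ π × m ≤ x′))
inversion-extend⁻ π p y<x with decreasing-extend⁻ π p (y<x ∷ [-])
... | x′ ∷ y′ ∷ [] , q , y′<x′ ∷ _ , inj₁ refl = inj₁ (x′ , y′ , q , y′<x′ , refl)
... | x′ ∷ [] , q , _ , inj₂ (m<x′ ∷ [] , refl) = inj₂ (refl , x′ , q , <shift⇒≤ m<x′)
... | [] , _ , _ , inj₁ ()
... | [] , _ , _ , inj₂ (_ , ())
... | _ ∷ _ ∷ [] , _ , _ , inj₂ (_ , ())
... | _ ∷ _ ∷ _ ∷ _ , _ , _ , inj₂ (_ , ())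

InversionsAtMost-extend : B < m → InversionsAtMost B π → InversionsAtMost m (extend π m)
InversionsAtMost-extend {π = π} B<m inv p y<x with inversion-extend⁻ π p y<x
... | inj₁ (_ , _ , q , y′<x′ , refl) =
  let y′≤B = inv q y′<x′ in
  subst (_≤ _) (sym (shift-< (≤-<-trans y′≤B B<m))) (≤-trans y′≤B (<⇒≤ B<m))
... | inj₂ (refl , _) = ≤-refl

InversionsAtMost-extend-max : All (_< m) π → InversionsAtMost B π → InversionsAtMost B (extend π m)
InversionsAtMost-extend-max {π = π} π<m inv p y<x with inversion-extend⁻ π p y<x
... | inj₁ (_ , _ , q , y′<x′ , refl) with All-resp-⊆ q π<m
...   | _ ∷ y′<m ∷ [] = subst (_≤ _) (sym (shift-< y′<m)) (inv q y′<x′)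
InversionsAtMost-extend-max {π = π} π<m inv p y<x | inj₂ (refl , _ , q , m≤x′) with All-resp-⊆ q π<m
...   | x′<m ∷ [] = contradiction m≤x′ (<⇒≱ x′<m)

¬Decreasing3-extend : ∀ π → B < m → InversionsAtMost B π →
  ¬ HasDecreasing 3 π → ¬ HasDecreasing 3 (extend π m)
¬Decreasing3-extend π B<m inv no-dec (s , p , len , l) with decreasing-extend⁻ π p l
... | t , q , l′ , inj₁ refl = no-dec (t , q , trans (sym (length-map _ t)) len , l′)
... | _ ∷ _ ∷ [] , q , y<x ∷ _ , inj₂ (_ ∷ m<y ∷ [] , refl) =
  contradiction (inv q y<x) (<⇒≱ (<-≤-trans B<m (<shift⇒≤ m<y)))
¬Decreasing3-extend π B<m inv no-dec (_ , _ , () , _) | [] , _ , _ , inj₂ (_ , refl)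
¬Decreasing3-extend π B<m inv no-dec (_ , _ , () , _) | _ ∷ [] , _ , _ , inj₂ (_ , refl)
¬Decreasing3-extend π B<m inv no-dec (_ , _ , () , _) | _ ∷ _ ∷ _ ∷ [] , _ , _ , inj₂ (_ , refl)
¬Decreasing3-extend π B<m inv no-dec (_ , _ , () , _) | _ ∷ _ ∷ _ ∷ _ ∷ _ , _ , _ , inj₂ (_ , refl)

-- The hypothesis 1 ≤ m makes Trap 0 π vacuous, as needed for the opening position.
Trap : ℕ → List ℕ → Set
Trap B π = ∀ {m} → 1 ≤ m → m ≤ B → HasDecreasing 3 (extend π m)

Trap-of-inversion : x ∷ y ∷ [] ⊆ π → y < x → Trap y π
Trap-of-inversion p y<x {m} _ m≤y =
  _ , map-shift-∷ʳ-⊆-extend p , refl ,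
  shift-mono-< m y<x ∷ subst (m <_) (sym (shift-≥ m≤y)) (s≤s m≤y) ∷ [-]

Trap-extend : [ x ] ⊆ π → m ≤ x → Trap m (extend π m)
Trap-extend p m≤x = Trap-of-inversion (inversion-⊆-extend p m≤x) (s≤s m≤x)

HasIncreasingUpTo : ℕ → ℕ → List ℕ → Set
HasIncreasingUpTo B k π = ∃[ s ] (s ⊆ π × Linked _<_ s × All (_≤ B) s × length s ≡ k)

HasIncreasingUpTo⇒HasIncreasing : HasIncreasingUpTo B k π → HasIncreasing k π
HasIncreasingUpTo⇒HasIncreasing (s , p , l , _ , len) = s , p , len , l

HasIncreasing⇒HasIncreasingUpTo : All (_≤ B) π → HasIncreasing k π → HasIncreasingUpTo B k π
HasIncreasing⇒HasIncreasingUpTo π≤B (s , p , len , l) = s , p , l , All-resp-⊆ p π≤B , len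

HasIncreasing-extend : HasIncreasing k π → HasIncreasing k (extend π m)
HasIncreasing-extend {m = m} (s , p , len , l) =
  map (shift m) s , map-shift-⊆-extend p , trans (length-map _ s) len ,
  Linked.map⁺ (Linked.map (shift-mono-< m) l)

HasIncreasingUpTo-extend-above : B < m →
  HasIncreasingUpTo B k π → HasIncreasingUpTo B k (extend π m)
HasIncreasingUpTo-extend-above B<m (s , p , l , s≤B , len) =
  s , ⊆-extend-below p (All.map (λ x≤B → ≤-<-trans x≤B B<m) s≤B) , l , s≤B , len

HasIncreasingUpTo-extend : B < m →
  HasIncreasingUpTo B k π → HasIncreasingUpTo m (suc k) (extend π m)
HasIncreasingUpTo-extend {m = m} B<m (s , p , l , s≤B , len) =
  s ++ [ m ] , ∷ʳ-⊆-extend-below p s<m , Linked-∷ʳ⁺ l s<m ,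
  All.∷ʳ⁺ (All.map <⇒≤ s<m) ≤-refl , trans (length-∷ʳ s m) (cong suc len)
  where
  s<m : All (_< m) s
  s<m = All.map (λ x≤B → ≤-<-trans x≤B B<m) s≤B

record Sized (n : ℕ) (π : List ℕ) : Set where
  field
    length≡ : length π ≡ n
    entries≤ : All (_≤ n) π
    max∈ : [ n ] ⊆ π

Sized-extend : Sized n π → m ≤ suc n → Sized (suc n) (extend π m)
Sized-extend {n} {π} {m} σ m≤1+n = record
  { length≡ = trans (length-extend π m) (cong suc length≡)
  ; entries≤ =
      All.∷ʳ⁺ (All.map⁺ (All.map (λ x≤n → ≤-trans (shift≤suc m _) (s≤s x≤n)) entries≤)) m≤1+n
  ; max∈ = max∈′
  }
  where
  open Sized σ
  max∈′ : [ suc n ] ⊆ extend π m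
  max∈′ with m ≤? n
  ... | yes m≤n = [suc]-⊆-extend max∈ m≤n
  ... | no m≰n rewrite ≤-antisym m≤1+n (≰⇒> m≰n) = map-shift-∷ʳ-⊆-extend ([]⊆-universal π)

record Invariant (n B v : ℕ) (π : List ℕ) : Set where
  field
    sized : Sized n π
    B<n : B < n
    no-decreasing3 : ¬ HasDecreasing 3 π
    inversions : InversionsAtMost B π
    trap : Trap B π
    lis-below-max : IncreasingBelowAtMost n v π
    lis : IncreasingBelowAtMost (suc n) (suc v) π
    low-run : HasIncreasingUpTo B v π
    run : HasIncreasing (suc v) π

record Endgame (n B k : ℕ) (π : List ℕ) : Set where
  field
    sized : Sized n π
    no-decreasing3 : ¬ HasDecreasing 3 π
    lis : IncreasingBelowAtMost (suc n) k π
    trap : Trap B π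
    low-run : HasIncreasingUpTo B k π

module AfterMiddleMove {n B v m π} (I : Invariant n B v π) (B<m : B < m) (m≤n : m ≤ n) where
  open Invariant I

  π′ : List ℕ
  π′ = extend π m

  sized′ : Sized (suc n) π′
  sized′ = Sized-extend sized (m≤n⇒m≤1+n m≤n)

  private
    no-decreasing3′ : ¬ HasDecreasing 3 π′
    no-decreasing3′ = ¬Decreasing3-extend π B<m inversions no-decreasing3

    inversions′ : InversionsAtMost m π′
    inversions′ = InversionsAtMost-extend B<m inversions

    lis′ : IncreasingBelowAtMost (2 + n) (suc v) π′
    lis′ = IncreasingBelowAtMost-extend (m≤n⇒m≤1+n m≤n) lis
             (IncreasingBelowAtMost-mono m≤n ≤-refl lis-below-max) ≤-refl

    low-run′ : HasIncreasingUpTo m (suc v) π′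
    low-run′ = HasIncreasingUpTo-extend B<m low-run

    m<2+n : m < 2 + n
    m<2+n = s≤s (m≤n⇒m≤1+n m≤n)

  step : Invariant (2 + n) m (suc v) (extend π′ (2 + n))
  step = record
    { sized = Sized-extend sized′ ≤-refl
    ; B<n = m<2+n
    ; no-decreasing3 = ¬Decreasing3-extend π′ m<2+n inversions′ no-decreasing3′
    ; inversions = InversionsAtMost-extend-max (All.map s≤s (Sized.entries≤ sized′)) inversions′
    ; trap = Trap-of-inversion
        (⊆-extend-below (inversion-⊆-extend (Sized.max∈ sized) m≤n) (≤-refl ∷ m<2+n ∷ []))
        (s≤s m≤n)
    ; lis-below-max = IncreasingBelowAtMost-extend-above ≤-refl lis′
    ; lis = IncreasingBelowAtMost-extend-suc ≤-refl lis′
    ; low-run = HasIncreasingUpTo-extend-above m<2+n low-run′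
    ; run = HasIncreasingUpTo⇒HasIncreasing (HasIncreasingUpTo-extend m<2+n low-run′)
    }

  endgame : Endgame (2 + n) (suc m) (2 + v) (extend π′ (suc m))
  endgame = record
    { sized = Sized-extend sized′ (s≤s (m≤n⇒m≤1+n m≤n))
    ; no-decreasing3 = ¬Decreasing3-extend π′ ≤-refl inversions′ no-decreasing3′
    ; lis = IncreasingBelowAtMost-extend-suc (s≤s (m≤n⇒m≤1+n m≤n)) lis′
    ; trap = Trap-extend (Sized.max∈ sized′) (s≤s m≤n)
    ; low-run = HasIncreasingUpTo-extend ≤-refl low-run′
    }

module AfterMaxMove {n B v π} (I : Invariant n B v π) where
  open Invariant I

  π′ : List ℕ
  π′ = extend π (suc n)

  sized′ : Sized (suc n) π′
  sized′ = Sized-extend sized ≤-refl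

  private
    B<1+n : B < suc n
    B<1+n = m≤n⇒m≤1+n B<n

    no-decreasing3′ : ¬ HasDecreasing 3 π′
    no-decreasing3′ = ¬Decreasing3-extend π B<1+n inversions no-decreasing3

    inversions′ : InversionsAtMost B π′
    inversions′ = InversionsAtMost-extend-max (All.map s≤s (Sized.entries≤ sized)) inversions

    lis′ : IncreasingBelowAtMost (2 + n) (2 + v) π′
    lis′ = IncreasingBelowAtMost-extend-suc ≤-refl lis

    lis-below-max′ : IncreasingBelowAtMost (suc n) (suc v) π′
    lis-below-max′ = IncreasingBelowAtMost-extend-above ≤-refl lis

    run-up-to-n : HasIncreasingUpTo n (suc v) π
    run-up-to-n = HasIncreasing⇒HasIncreasingUpTo (Sized.entries≤ sized) run

  step : Invariant (2 + n) n (suc v) (extend π′ n)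
  step = record
    { sized = Sized-extend sized′ (m≤n+m n 2)
    ; B<n = m<n⇒m<1+n (n<1+n n)
    ; no-decreasing3 = ¬Decreasing3-extend π′ B<n inversions′ no-decreasing3′
    ; inversions = InversionsAtMost-extend B<n inversions′
    ; trap = Trap-extend (Sized.max∈ sized′) (n≤1+n n)
    ; lis-below-max = IncreasingBelowAtMost-extend (n≤1+n n) lis-below-max′
        (IncreasingBelowAtMost-extend-above (n≤1+n n) lis-below-max) ≤-refl
    ; lis = IncreasingBelowAtMost-extend (m≤n+m n 2) lis′
        (IncreasingBelowAtMost-mono (n≤1+n n) ≤-refl lis-below-max′) ≤-refl
    ; low-run = HasIncreasingUpTo-extend B<n (HasIncreasingUpTo-extend-above B<1+n low-run)
    ; run = HasIncreasing-extend
        (HasIncreasingUpTo⇒HasIncreasing (HasIncreasingUpTo-extend ≤-refl run-up-to-n))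
    }

  endgame : Endgame (2 + n) (suc n) (2 + v) (extend π′ (suc n))
  endgame = record
    { sized = Sized-extend sized′ (n≤1+n (suc n))
    ; no-decreasing3 = ¬Decreasing3-extend π′ B<1+n inversions′ no-decreasing3′
    ; lis = IncreasingBelowAtMost-extend (n≤1+n (suc n)) lis′ lis-below-max′ ≤-refl
    ; trap = Trap-extend (Sized.max∈ sized′) ≤-refl
    ; low-run =
        HasIncreasingUpTo-extend ≤-refl (HasIncreasingUpTo-extend-above ≤-refl run-up-to-n)
    }

initial : Invariant 1 0 0 (1 ∷ [])
initial = record
  { sized = record { length≡ = refl ; entries≤ = ≤-refl ∷ [] ; max∈ = ⊆-refl }
  ; B<n = ≤-refl
  ; no-decreasing3 = λ { (_ , p , len , _) →
      contradiction (subst (_≤ 1) len (length-mono-≤ p)) λ { (s≤s ()) } }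
  ; inversions = λ p _ → contradiction (length-mono-≤ p) λ { (s≤s ()) }
  ; trap = λ 1≤m m≤0 → contradiction (≤-trans 1≤m m≤0) λ ()
  ; lis-below-max = λ
      { (_ ∷ʳ []) _ _ → z≤n
      ; (refl ∷ []) _ (1<1 ∷ []) → contradiction 1<1 (<-irrefl refl)
      }
  ; lis = λ p _ _ → length-mono-≤ p
  ; low-run = [] , []⊆-universal _ , [] , [] , refl
  ; run = _ , ⊆-refl , refl , [-]
  }

legal-move : Sized n π → 1 ≤ m → m ≤ suc n → LegalMove π m
legal-move {m = m} σ 1≤m m≤1+n = 1≤m , subst (λ k → m ≤ suc k) (sym (Sized.length≡ σ)) m≤1+n

module _ {a : ℕ} where

  ¬Ended-of-bounds : Sized n π → ¬ HasDecreasing 3 π → IncreasingBelowAtMost (suc n) ℓ π → ℓ < a →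
    ¬ Ended a 3 π
  ¬Ended-of-bounds σ _ lis ℓ<a (inj₁ (s , p , len , l)) =
    <⇒≱ ℓ<a (subst (_≤ _) len (lis p l (All-resp-⊆ p (All.map s≤s (Sized.entries≤ σ)))))
  ¬Ended-of-bounds _ no-dec _ _ (inj₂ dec) = no-dec dec

  Endgame-lost : Endgame n B k π → suc k ≡ a → ¬ Ended a 3 π × Loses a 3 π
  Endgame-lost {B = B} {π = π} E refl =
    ¬Ended-of-bounds sized no-decreasing3 lis ≤-refl , loses reply
    where
    open Endgame E
    reply : ∀ m → LegalMove π m → Ended a 3 (extend π m) ⊎ Wins a 3 (extend π m)
    reply m (1≤m , _) with m ≤? B
    ... | yes m≤B = inj₁ (inj₂ (trap 1≤m m≤B))
    ... | no m≰B =
      inj₁ (inj₁ (HasIncreasingUpTo⇒HasIncreasing (HasIncreasingUpTo-extend (≰⇒> m≰B) low-run)))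

  -- d counts the rounds left before Player 1 switches to the endgame answers.
  Invariant-lost : ∀ d → d + (3 + v) ≡ a → Invariant n B v π → ¬ Ended a 3 π × Loses a 3 π
  wins-after-middle : ∀ d → d + (3 + v) ≡ a → Invariant n B v π → B < m → m ≤ n →
    Wins a 3 (extend π m)
  wins-after-max : ∀ d → d + (3 + v) ≡ a → Invariant n B v π → Wins a 3 (extend π (suc n))

  Invariant-lost {v} {n} {B} {π} d eq I =
    ¬Ended-of-bounds sized no-decreasing3 lis (subst (_ ≤_) eq (≤-trans (n≤1+n _) (m≤n+m _ d))) ,
    loses reply
    where
    open Invariant I
    reply : ∀ m → LegalMove π m → Ended a 3 (extend π m) ⊎ Wins a 3 (extend π m)
    reply m (1≤m , m≤1+len)
      with m ≤? B | m≤n⇒m<n∨m≡n (subst (λ k → m ≤ suc k) (Sized.length≡ sized) m≤1+len)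
    ... | yes m≤B | _          = inj₁ (inj₂ (trap 1≤m m≤B))
    ... | no m≰B  | inj₁ m<1+n = inj₂ (wins-after-middle d eq I (≰⇒> m≰B) (≤-pred m<1+n))
    ... | no _    | inj₂ refl  = inj₂ (wins-after-max d eq I)

  wins-after-middle {m = m} zero eq I B<m m≤n =
    uncurry (wins (suc m) (legal-move sized′ (s≤s z≤n) (s≤s (m≤n⇒m≤1+n m≤n))))
      (Endgame-lost endgame eq)
    where open AfterMiddleMove I B<m m≤n
  wins-after-middle {n = n} (suc d) eq I B<m m≤n =
    uncurry (wins (2 + n) (legal-move sized′ (s≤s z≤n) ≤-refl))
      (Invariant-lost d (trans (+-suc d _) eq) step)
    where open AfterMiddleMove I B<m m≤n

  wins-after-max {n = n} zero eq I =
    uncurry (wins (suc n) (legal-move sized′ (s≤s z≤n) (n≤1+n (suc n)))) (Endgame-lost endgame eq)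
    where open AfterMaxMove I
  wins-after-max {n = n} (suc d) eq I =
    uncurry (wins n (legal-move sized′ (≤-<-trans z≤n (Invariant.B<n I)) (m≤n+m n 2)))
      (Invariant-lost d (trans (+-suc d _) eq) step)
    where open AfterMaxMove I

theorem2 : (a : ℕ) → 3 ≤ a → Player1Wins a 3
theorem2 a 3≤a =
  uncurry (wins 1 (≤-refl , s≤s z≤n)) (Invariant-lost (a ∸ 3) (m∸n+n≡m 3≤a) initial)
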